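{- Let $\mathcal N$ be a phylogenetic network on $X$, let $\{a,b\}$ be a cherry of $\mathcal N$, and let $\mathcal N'$ be the phylogenetic network on $X-\{b\}$ obtained from $\mathcal N$ by reducing $b$. If $A\subseteq X-\{b\}$, then $\mathcal N_A=\mathcal N'_A$.
   Context: All paths are directed. A (binary) phylogenetic network $\mathcal N$ on a non-empty finite set $X$ is a rooted acyclic directed graph with no parallel arcs such that: the unique root has in-degree 0 and out-degree 2; the set of vertices of out-degree 0 is $X$ (the leaves), each of in-degree 1; every other vertex has either in-degree 1 and out-degree 2 (tree vertex) or in-degree 2 and out-degree 1 (reticulation). If $|X|=1$, $\mathcal N$ may also be the single vertex of $X$. For $|X|\ge2$, $p_x$ is the parent of leaf $x$. $\{a,b\}$ is a cherry if $p_a=p_b$. Reducing $b$: delete $b$ and its incident arc and suppress the resulting degree-two vertex $p_a$ (if $p_a$ is the root, the result is the single vertex $a$). A stable ancestor of $X'\subseteq X$ is a vertex $u$ such that for every $x\in X'$ every path from the root to $x$ traverses $u$; ${\rm lsa}(X')$ is the unique stable ancestor of $X'$ with no other stable ancestor of $X'$ as a descendant. The path graph of $\mathcal N$ on $A$ is the subgraph consisting of all vertices and arcs on paths from ${\rm lsa}(A)$ to leaves in $A$. The full simplification of a directed graph is obtained by repeatedly suppressing vertices of in-degree one and out-degree one and deleting exactly one arc of any pair of parallel arcs until neither applies; $\mathcal N_A$, the network exhibited by $\mathcal N$ on $A$, is the full simplification of the path graph. -}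

module Defs where

open import Data.Nat using (ℕ; _≟_)
open import Data.Bool using (Bool; true; false; not; _∧_; _∨_)
open import Data.Product using (Σ; ∃; _×_; _,_; proj₁; proj₂; map)
open import Data.Sum using (_⊎_)
open import Data.List using (List; []; _∷_; _++_; length; filterᵇ; [_])
import Data.List as L
open import Data.List.Membership.Propositional using (_∈_)
open import Data.List.Relation.Unary.Unique.Propositional using (Unique)
open import Data.List.Relation.Binary.Permutation.Propositional using (_↭_)
open import Relation.Nullary using (¬_; does)
open import Relation.Binary.PropositionalEquality using (_≡_; _≢_)
open import Function.Bundles using (_⇔_)

-- Arcs form a list (a multiset), so parallel arcs are representable.
-- Leaves are identified with their labels: a phylogenetic network on X
-- has X (a list of vertex names) as its set of out-degree-0 vertices.

record Graph : Set where
  constructor mkGraph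
  field
    verts : List ℕ
    arcs  : List (ℕ × ℕ)
open Graph public

Arc : Graph → ℕ → ℕ → Set
Arc G u v = (u , v) ∈ arcs G

eqᵇ : ℕ → ℕ → Bool
eqᵇ m n = does (m ≟ n)

indeg : Graph → ℕ → ℕ
indeg G v = length (filterᵇ (λ e → eqᵇ (proj₂ e) v) (arcs G))

outdeg : Graph → ℕ → ℕ
outdeg G v = length (filterᵇ (λ e → eqᵇ (proj₁ e) v) (arcs G))

data Path (G : Graph) : ℕ → ℕ → Set where
  here : ∀ {v} → Path G v v
  step : ∀ {u w v} → Arc G u w → Path G w v → Path G u v

pathVerts : ∀ {G u v} → Path G u v → List ℕ
pathVerts {v = v} here = [ v ]
pathVerts {u = u} (step _ p) = u ∷ pathVerts p

Reach : Graph → ℕ → ℕ → Set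
Reach G u v = Path G u v

Acyclic : Graph → Set
Acyclic G = ∀ u v → Arc G u v → ¬ Reach G v u

record IsRoot (G : Graph) (ρ : ℕ) : Set where
  field
    root∈   : ρ ∈ verts G
    rootIn0 : indeg G ρ ≡ 0

record IsBigNetwork (G : Graph) (X : List ℕ) : Set where
  field
    arcsWF      : ∀ u v → Arc G u v → (u ∈ verts G) × (v ∈ verts G)
    vertsUnique : Unique (verts G)
    noParallel  : Unique (arcs G)
    acyclic     : Acyclic G
    root        : ℕ
    root∈       : root ∈ verts G
    rootIn      : indeg G root ≡ 0
    rootOut     : outdeg G root ≡ 2
    leaves⊆     : ∀ x → x ∈ X → x ∈ verts G
    rootNotLeaf : ¬ (root ∈ X)
    others      : ∀ v → v ∈ verts G → v ≢ root →
                    ((v ∈ X) × indeg G v ≡ 1 × outdeg G v ≡ 0)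
                  ⊎ ((¬ (v ∈ X)) × indeg G v ≡ 1 × outdeg G v ≡ 2)
                  ⊎ ((¬ (v ∈ X)) × indeg G v ≡ 2 × outdeg G v ≡ 1)

singleVertex : ℕ → Graph
singleVertex x = mkGraph [ x ] []

IsNetwork : Graph → List ℕ → Set
IsNetwork G X = IsBigNetwork G X ⊎ (∃ λ x → G ≡ singleVertex x × X ≡ [ x ])

Cherry : Graph → List ℕ → ℕ → ℕ → Set
Cherry G X a b = a ∈ X × b ∈ X × a ≢ b × ∃ λ p → Arc G p a × Arc G p b

removeVert : ℕ → List ℕ → List ℕ
removeVert v = filterᵇ (λ x → not (eqᵇ x v))

removeIncident : ℕ → List (ℕ × ℕ) → List (ℕ × ℕ)
removeIncident v = filterᵇ (λ e → not (eqᵇ (proj₁ e) v ∨ eqᵇ (proj₂ e) v))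

-- `ReduceLeaf G a b G'`: G' is obtained from G (with cherry {a,b}) by
-- deleting b and its incident arc and suppressing the parent p of a and b;
-- if p is the root, the result is the single vertex a.
data ReduceLeaf (G : Graph) (a b : ℕ) : Graph → Set where
  atRoot : ∀ p → Arc G p a → Arc G p b → indeg G p ≡ 0 →
           ReduceLeaf G a b (singleVertex a)
  inner  : ∀ p q → Arc G p a → Arc G p b → Arc G q p →
           ReduceLeaf G a b
             (mkGraph (removeVert p (removeVert b (verts G)))
                      ((q , a) ∷ removeIncident p (removeIncident b (arcs G))))

StableAncestor : Graph → List ℕ → ℕ → Set
StableAncestor G A u =
  u ∈ verts G ×
  (∀ ρ → IsRoot G ρ → ∀ x → x ∈ A → (P : Path G ρ x) → u ∈ pathVerts P)

IsLsa : Graph → List ℕ → ℕ → Set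
IsLsa G A u = StableAncestor G A u ×
              (∀ w → StableAncestor G A w → Reach G u w → w ≡ u)

OnPathToA : Graph → ℕ → List ℕ → ℕ → Set
OnPathToA G u A v = Reach G u v × ∃ λ x → x ∈ A × Reach G v x

record IsPathGraph (G : Graph) (A : List ℕ) (u : ℕ) (P : Graph) : Set where
  field
    vertsU : Unique (verts P)
    vertsC : ∀ v → v ∈ verts P ⇔ (v ∈ verts G × OnPathToA G u A v)
    arcsU  : Unique (arcs P)
    arcsC  : ∀ v w → (v , w) ∈ arcs P ⇔
               (Arc G v w × Reach G u v × ∃ λ x → x ∈ A × Reach G w x)

data SimpStep (G : Graph) : Graph → Set where
  suppress : ∀ u v w → v ∈ verts G → indeg G v ≡ 1 → outdeg G v ≡ 1 →
             Arc G u v → Arc G v w →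
             SimpStep G (mkGraph (removeVert v (verts G))
                                 ((u , w) ∷ removeIncident v (arcs G)))
  dropParallel : ∀ l₁ e l₂ → arcs G ≡ l₁ ++ e ∷ l₂ → e ∈ l₁ ++ l₂ →
                 SimpStep G (mkGraph (verts G) (l₁ ++ l₂))

data SimpStar : Graph → Graph → Set where
  done : ∀ {G} → SimpStar G G
  more : ∀ {G H K} → SimpStep G H → SimpStar H K → SimpStar G K

IsFullSimplification : Graph → Graph → Set
IsFullSimplification G S = SimpStar G S × (∀ H → ¬ SimpStep S H)

Iso : List ℕ → Graph → Graph → Set
Iso A S T = Σ (ℕ → ℕ) λ f → Σ (ℕ → ℕ) λ g →
    (∀ v → v ∈ verts S → f v ∈ verts T × g (f v) ≡ v)
  × (∀ v → v ∈ verts T → g v ∈ verts S × f (g v) ≡ v)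
  × (L.map (map f f) (arcs S) ↭ arcs T)
  × (∀ x → x ∈ A → f x ≡ x)

-- N_A ≅ N'_A for every choice of lsa and of full simplification
SameExhibited : List ℕ → Graph → Graph → Set
SameExhibited A G G' =
  ∀ u u' P P' S S' →
    IsLsa G A u → IsLsa G' A u' →
    IsPathGraph G A u P → IsPathGraph G' A u' P' →
    IsFullSimplification P S → IsFullSimplification P' S' →
    Iso A S S'

-- Let p be the parent of the cherry and, unless p is the root, q the parent of p. Paths of N′
-- are the paths of N avoiding b, with q → p → a contracted to q → a; hence the lsa of A is the
-- same vertex in N and N′, and the path graph of N′ is that of N with p suppressed if p lies on
-- it. (If p is the root, every leaf of A is a and both path graphs are the single vertex a.)
-- On the other hand, full simplification of an acyclic graph is unique up to equality of vertex
-- sets and arc multisets: any two competing steps are joined by at most one further step on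
-- each side, so uniqueness of normal forms follows by induction on the reductions.

module Submission where

open import Defs
open import Data.Bool using (Bool; true; false; not; _∨_; T; T?; if_then_else_)
open import Data.Empty using (⊥; ⊥-elim)
open import Data.List using (List; []; _∷_; _++_; [_]; length; filterᵇ)
open import Data.List.Properties using (filter-accept; filter-reject; filter-++; map-id)
open import Data.List.Membership.Propositional using (_∈_; _∉_)
open import Data.List.Membership.Propositional.Properties using (∈-filter⁺; ∈-filter⁻; ∈-∃++; ∈-++⁺ʳ)
open import Data.List.Relation.Binary.Subset.Propositional using (_⊆_)
open import Data.List.Relation.Binary.Permutation.Propositional
  using (_↭_; ↭-refl; ↭-sym; ↭-trans; ↭-prep; ↭-reflexive; swap; ↭⇒↭ₛ; module PermutationReasoning)
open import Data.List.Relation.Binary.Permutation.Propositional.Properties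
  using (∈-resp-↭; shift; ↭-length; filter-↭; drop-mid; drop-mid-≡)
import Data.List.Relation.Binary.Permutation.Setoid.Properties as ↭ₛ
open import Data.List.Relation.Unary.All using (All; []; _∷_)
import Data.List.Relation.Unary.All as All
open import Data.List.Relation.Unary.All.Properties using (All¬⇒¬Any; ¬Any⇒All¬)
open import Data.List.Relation.Unary.Any using (here; there)
open import Data.List.Relation.Unary.Any.Properties using (singleton⁻)
open import Data.List.Relation.Unary.Unique.Propositional using (Unique; []; _∷_)
import Data.List.Relation.Unary.Unique.Propositional.Properties as Unique
open import Data.Nat using (ℕ; zero; suc; _+_; _≤_; _<_; z≤n; s≤s; _≟_)
open import Data.Nat.Properties
  using (≤-refl; ≤-trans; ≤-reflexive; <-≤-trans; n≮n; +-suc; +-identityʳ; ≡ᵇ⇒≡; ≡⇒≡ᵇ)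
open import Data.List.Membership.DecPropositional _≟_ using (_∈?_)
open import Data.Product using (Σ; ∃; ∃₂; _×_; _,_; proj₁; proj₂)
open import Data.Product.Properties using (≡-dec)
open import Data.Sum using (_⊎_; inj₁; inj₂)
open import Function using (_∘_; id)
open import Function.Bundles using (Equivalence)
open import Relation.Nullary using (¬_; yes; no)
open import Relation.Binary.PropositionalEquality using (_≡_; _≢_; refl; sym; trans; cong; subst; module ≡-Reasoning)
open import Relation.Binary.PropositionalEquality.Properties using (setoid)

module _ {A : Set} where

  filterᵇ-∷ : (p : A → Bool) (x : A) (xs : List A) →
              filterᵇ p (x ∷ xs) ≡ (if p x then x ∷ filterᵇ p xs else filterᵇ p xs)
  filterᵇ-∷ p x xs with p x
  ... | true  = refl
  ... | false = refl

  filterᵇ-comm : (p q : A → Bool) (xs : List A) →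
                 filterᵇ p (filterᵇ q xs) ≡ filterᵇ q (filterᵇ p xs)
  filterᵇ-comm p q [] = refl
  filterᵇ-comm p q (x ∷ xs) rewrite filterᵇ-∷ q x xs | filterᵇ-∷ p x xs with p x in px | q x in qx
  ... | true  | true
    rewrite filterᵇ-∷ p x (filterᵇ q xs) | filterᵇ-∷ q x (filterᵇ p xs) | px | qx
    = cong (x ∷_) (filterᵇ-comm p q xs)
  ... | true  | false rewrite filterᵇ-∷ q x (filterᵇ p xs) | qx = filterᵇ-comm p q xs
  ... | false | true  rewrite filterᵇ-∷ p x (filterᵇ q xs) | px = filterᵇ-comm p q xs
  ... | false | false = filterᵇ-comm p q xs

  length≡1⇒≡[_] : ∀ {x} {xs : List A} → length xs ≡ 1 → x ∈ xs → xs ≡ [ x ]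
  length≡1⇒≡[_] {xs = _ ∷ []} _ (here refl) = refl

  ∈-++-delete : ∀ {x y : A} xs ys → x ∈ xs ++ y ∷ ys → x ≢ y → x ∈ xs ++ ys
  ∈-++-delete []       ys (here refl) x≢y = ⊥-elim (x≢y refl)
  ∈-++-delete []       ys (there x∈)  x≢y = x∈
  ∈-++-delete (_ ∷ xs) ys (here refl) x≢y = here refl
  ∈-++-delete (_ ∷ xs) ys (there x∈)  x≢y = there (∈-++-delete xs ys x∈ x≢y)

  unique-resp-↭ : ∀ {xs ys : List A} → xs ↭ ys → Unique xs → Unique ys
  unique-resp-↭ xs↭ys = ↭ₛ.Unique-resp-↭ (setoid A) (↭⇒↭ₛ xs↭ys)

  unique-⊆⇒length≤ : ∀ {xs ys : List A} → Unique xs → xs ⊆ ys → length xs ≤ length ys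
  unique-⊆⇒length≤ {[]}     _          _  = z≤n
  unique-⊆⇒length≤ {x ∷ xs} (x∉ ∷ uxs) xs⊆ with ∈-∃++ (xs⊆ (here refl))
  ... | ys₁ , ys₂ , refl = ≤-trans (s≤s (unique-⊆⇒length≤ uxs xs⊆ys₁++ys₂))
                                   (≤-reflexive (sym (↭-length (shift x ys₁ ys₂))))
    where
    xs⊆ys₁++ys₂ : xs ⊆ ys₁ ++ ys₂
    xs⊆ys₁++ys₂ z∈ = ∈-++-delete ys₁ ys₂ (xs⊆ (there z∈)) (λ { refl → All¬⇒¬Any x∉ z∈ })

  unique-all-≡⇒length≡1 : ∀ {c : A} {xs} → Unique xs → (∀ {y} → y ∈ xs → y ≡ c) → c ∈ xs →
                          length xs ≡ 1
  unique-all-≡⇒length≡1 {xs = _ ∷ []}    _                   _    _ = refl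
  unique-all-≡⇒length≡1 {xs = _ ∷ _ ∷ _} ((y≢z ∷ _) ∷ _) all≡c _ =
    ⊥-elim (y≢z (trans (all≡c (here refl)) (sym (all≡c (there (here refl))))))

  unique-⊆⇒↭ : ∀ {xs ys : List A} → Unique xs → Unique ys → xs ⊆ ys → ys ⊆ xs → xs ↭ ys
  unique-⊆⇒↭ {[]}     {[]}    _ _ _ _   = ↭-refl
  unique-⊆⇒↭ {[]}     {_ ∷ _} _ _ _ ys⊆ with ys⊆ (here refl)
  ... | ()
  unique-⊆⇒↭ {x ∷ xs} (x∉ ∷ uxs) uys xs⊆ ys⊆ with ∈-∃++ (xs⊆ (here refl))
  ... | ys₁ , ys₂ , refl with unique-resp-↭ (shift x ys₁ ys₂) uys
  ...   | x∉ys ∷ uys′ =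
    ↭-trans (↭-prep x (unique-⊆⇒↭ uxs uys′ ⊆ys₁++ys₂ ys₁++ys₂⊆)) (↭-sym (shift x ys₁ ys₂))
    where
    ⊆ys₁++ys₂ : xs ⊆ ys₁ ++ ys₂
    ⊆ys₁++ys₂ z∈ = ∈-++-delete ys₁ ys₂ (xs⊆ (there z∈)) (λ { refl → All¬⇒¬Any x∉ z∈ })
    ys₁++ys₂⊆ : ys₁ ++ ys₂ ⊆ xs
    ys₁++ys₂⊆ z∈ with ys⊆ (∈-resp-↭ (↭-sym (shift x ys₁ ys₂)) (there z∈))
    ... | here refl = ⊥-elim (All¬⇒¬Any x∉ys z∈)
    ... | there z∈xs = z∈xs

  1≤length : ∀ {a : A} {as} → a ∈ as → 1 ≤ length as
  1≤length {as = _ ∷ _} _ = s≤s z≤n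

  ∈-++-insert : ∀ {a b : A} xs ys → a ∈ xs ++ ys → a ∈ xs ++ b ∷ ys
  ∈-++-insert []       _ a∈         = there a∈
  ∈-++-insert (_ ∷ xs) _ (here refl) = here refl
  ∈-++-insert (_ ∷ xs) _ (there a∈)  = there (∈-++-insert xs _ a∈)

module _ {A : Set} (p : A → Bool) {e : A} (l₁ l₂ : List A) where

  length-filterᵇ-shift : length (filterᵇ p (l₁ ++ e ∷ l₂)) ≡ length (filterᵇ p (e ∷ l₁ ++ l₂))
  length-filterᵇ-shift = ↭-length (filter-↭ (T? ∘ p) (shift e l₁ l₂))

  length-filterᵇ-duplicate : e ∈ l₁ ++ l₂ → T (p e) → 2 ≤ length (filterᵇ p (l₁ ++ e ∷ l₂))
  length-filterᵇ-duplicate e∈ pe rewrite length-filterᵇ-shift | filter-accept (T? ∘ p) {xs = l₁ ++ l₂} pe =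
    s≤s (1≤length (∈-filter⁺ (T? ∘ p) e∈ pe))

  length-filterᵇ-delete : ¬ T (p e) → length (filterᵇ p (l₁ ++ e ∷ l₂)) ≡ length (filterᵇ p (l₁ ++ l₂))
  length-filterᵇ-delete ¬pe rewrite length-filterᵇ-shift | filter-reject (T? ∘ p) {xs = l₁ ++ l₂} ¬pe = refl

ArcList : Set
ArcList = List (ℕ × ℕ)

arcsInto : ℕ → ArcList → ArcList
arcsInto v = filterᵇ (λ e → eqᵇ (proj₂ e) v)

arcsOutOf : ℕ → ArcList → ArcList
arcsOutOf v = filterᵇ (λ e → eqᵇ (proj₁ e) v)

avoidsᵇ : ℕ → ℕ × ℕ → Bool
avoidsᵇ v e = not (eqᵇ (proj₁ e) v ∨ eqᵇ (proj₂ e) v)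

private
  variable
    u v w x y u′ v′ w′ : ℕ
    xs ys : List ℕ
    es : ArcList

eqᵇ⇒≡ : T (eqᵇ x y) → x ≡ y
eqᵇ⇒≡ = ≡ᵇ⇒≡ _ _

≡⇒eqᵇ : x ≡ y → T (eqᵇ x y)
≡⇒eqᵇ = ≡⇒≡ᵇ _ _

not-eqᵇ⇒≢ : T (not (eqᵇ x y)) → x ≢ y
not-eqᵇ⇒≢ {x} {y} t x≡y with eqᵇ x y | ≡⇒eqᵇ {x} {y} x≡y
... | true | _ = t

eqᵇ≡true⇒≡ : eqᵇ x y ≡ true → x ≡ y
eqᵇ≡true⇒≡ eq = eqᵇ⇒≡ (subst T (sym eq) _)

≢⇒not-eqᵇ : x ≢ y → T (not (eqᵇ x y))
≢⇒not-eqᵇ {x} {y} x≢y with eqᵇ x y in eq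
... | true  = x≢y (eqᵇ≡true⇒≡ eq)
... | false = _

T-not-∨⁻ : ∀ {b c} → T (not (b ∨ c)) → T (not b) × T (not c)
T-not-∨⁻ {false} {false} _ = _ , _

T-not-∨⁺ : ∀ {b c} → T (not b) → T (not c) → T (not (b ∨ c))
T-not-∨⁺ {false} {false} _ _ = _

avoids⁻ : T (not (eqᵇ x v ∨ eqᵇ y v)) → x ≢ v × y ≢ v
avoids⁻ t with x≠v , y≠v ← T-not-∨⁻ t = not-eqᵇ⇒≢ x≠v , not-eqᵇ⇒≢ y≠v

avoids⁺ : x ≢ v → y ≢ v → T (not (eqᵇ x v ∨ eqᵇ y v))
avoids⁺ x≢v y≢v = T-not-∨⁺ (≢⇒not-eqᵇ x≢v) (≢⇒not-eqᵇ y≢v)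

∈-removeVert⁻ : x ∈ removeVert v xs → x ∈ xs × x ≢ v
∈-removeVert⁻ x∈ with ∈-filter⁻ _ x∈
... | x∈xs , t = x∈xs , not-eqᵇ⇒≢ t

∈-removeVert⁺ : x ∈ xs → x ≢ v → x ∈ removeVert v xs
∈-removeVert⁺ x∈ x≢v = ∈-filter⁺ _ x∈ (≢⇒not-eqᵇ x≢v)

∈-removeIncident⁻ : (x , y) ∈ removeIncident v es → (x , y) ∈ es × x ≢ v × y ≢ v
∈-removeIncident⁻ e∈ with ∈-filter⁻ _ e∈
... | e∈es , t = e∈es , avoids⁻ t

∈-removeIncident⁺ : (x , y) ∈ es → x ≢ v → y ≢ v → (x , y) ∈ removeIncident v es
∈-removeIncident⁺ e∈ x≢v y≢v = ∈-filter⁺ _ e∈ (avoids⁺ x≢v y≢v)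

removeIncident-accept : x ≢ v → y ≢ v → removeIncident v ((x , y) ∷ es) ≡ (x , y) ∷ removeIncident v es
removeIncident-accept {v = v} x≢v y≢v = filter-accept (T? ∘ avoidsᵇ v) (avoids⁺ x≢v y≢v)

removeIncident-reject : x ≡ v ⊎ y ≡ v → removeIncident v ((x , y) ∷ es) ≡ removeIncident v es
removeIncident-reject {x = x} {v = v} {y = y} {es = es} incident =
  filter-reject (T? ∘ avoidsᵇ v) {x , y} {es} (rejected incident ∘ avoids⁻ {x} {v} {y})
  where
  rejected : x ≡ v ⊎ y ≡ v → ¬ (x ≢ v × y ≢ v)
  rejected (inj₁ x≡v) (x≢v , _) = x≢v x≡v
  rejected (inj₂ y≡v) (_ , y≢v) = y≢v y≡v

removeIncident-comm : ∀ v v′ es → removeIncident v (removeIncident v′ es) ≡ removeIncident v′ (removeIncident v es)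
removeIncident-comm v v′ = filterᵇ-comm _ _

∈-arcsInto⁺ : (u , v) ∈ es → (u , v) ∈ arcsInto v es
∈-arcsInto⁺ {v = v} e∈ = ∈-filter⁺ _ e∈ (≡⇒eqᵇ {v} refl)

∈-arcsInto⁻ : (u , w) ∈ arcsInto v es → (u , w) ∈ es × w ≡ v
∈-arcsInto⁻ e∈ with ∈-filter⁻ _ e∈
... | e∈es , t = e∈es , eqᵇ⇒≡ t

∈-arcsOutOf⁺ : (v , w) ∈ es → (v , w) ∈ arcsOutOf v es
∈-arcsOutOf⁺ {v = v} e∈ = ∈-filter⁺ _ e∈ (≡⇒eqᵇ {v} refl)

∈-arcsOutOf⁻ : (u , w) ∈ arcsOutOf v es → (u , w) ∈ es × u ≡ v
∈-arcsOutOf⁻ e∈ with ∈-filter⁻ _ e∈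
... | e∈es , t = e∈es , eqᵇ⇒≡ t

length-arcsInto-split : x ≢ v → ∀ es →
  length (arcsInto x es) ≡ length (arcsInto x (arcsOutOf v es)) + length (arcsInto x (removeIncident v es))
length-arcsInto-split x≢v [] = refl
length-arcsInto-split {x} {v} x≢v ((a , c) ∷ es)
  with IH ← length-arcsInto-split x≢v es | eqᵇ a v | eqᵇ c v in cv | eqᵇ c x in cx
... | true  | _     | true  rewrite cx = cong suc IH
... | true  | _     | false rewrite cx = IH
... | false | true  | true  = ⊥-elim (x≢v (trans (sym (eqᵇ≡true⇒≡ {c} cx)) (eqᵇ≡true⇒≡ {c} cv)))
... | false | true  | false = IH
... | false | false | true  rewrite cx = trans (cong suc IH) (sym (+-suc _ _))
... | false | false | false rewrite cx = IH

length-arcsOutOf-split : x ≢ v → ∀ es →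
  length (arcsOutOf x es) ≡ length (arcsOutOf x (arcsInto v es)) + length (arcsOutOf x (removeIncident v es))
length-arcsOutOf-split x≢v [] = refl
length-arcsOutOf-split {x} {v} x≢v ((a , c) ∷ es)
  with IH ← length-arcsOutOf-split x≢v es | eqᵇ c v | eqᵇ a v in av | eqᵇ a x in ax
... | true  | true  | true  rewrite ax = cong suc IH
... | true  | true  | false rewrite ax = IH
... | true  | false | true  rewrite ax = cong suc IH
... | true  | false | false rewrite ax = IH
... | false | true  | true  = ⊥-elim (x≢v (trans (sym (eqᵇ≡true⇒≡ {a} ax)) (eqᵇ≡true⇒≡ {a} av)))
... | false | true  | false = IH
... | false | false | true  rewrite ax = trans (cong suc IH) (sym (+-suc _ _))
... | false | false | false rewrite ax = IH

length-arcsInto-∷ : ∀ x u u′ w es →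
  length (arcsInto x ((u , w) ∷ es)) ≡ length (arcsInto x [ (u′ , w) ]) + length (arcsInto x es)
length-arcsInto-∷ x _ _ w _ with eqᵇ w x
... | true  = refl
... | false = refl

length-arcsOutOf-∷ : ∀ x u w w′ es →
  length (arcsOutOf x ((u , w) ∷ es)) ≡ length (arcsOutOf x [ (u , w′) ]) + length (arcsOutOf x es)
length-arcsOutOf-∷ x u _ _ _ with eqᵇ u x
... | true  = refl
... | false = refl

module _ {G : Graph} where

  Arc⇒1≤indeg : Arc G u v → 1 ≤ indeg G v
  Arc⇒1≤indeg uv = 1≤length (∈-arcsInto⁺ uv)

  Arc⇒1≤outdeg : Arc G u v → 1 ≤ outdeg G u
  Arc⇒1≤outdeg uv = 1≤length (∈-arcsOutOf⁺ uv)

  arcsInto≡[_] : indeg G v ≡ 1 → Arc G u v → arcsInto v (arcs G) ≡ [ (u , v) ]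
  arcsInto≡[ in1 ] uv = length≡1⇒≡[ in1 ] (∈-arcsInto⁺ uv)

  arcsOutOf≡[_] : outdeg G v ≡ 1 → Arc G v w → arcsOutOf v (arcs G) ≡ [ (v , w) ]
  arcsOutOf≡[ out1 ] vw = length≡1⇒≡[ out1 ] (∈-arcsOutOf⁺ vw)

  indeg≡1⇒parent-unique : indeg G v ≡ 1 → Arc G u v → Arc G w v → u ≡ w
  indeg≡1⇒parent-unique in1 uv wv with subst ((_ , _) ∈_) (arcsInto≡[ in1 ] uv) (∈-arcsInto⁺ wv)
  ... | here refl = refl

  outdeg≡1⇒child-unique : outdeg G v ≡ 1 → Arc G v u → Arc G v w → u ≡ w
  outdeg≡1⇒child-unique out1 vu vw with subst ((_ , _) ∈_) (arcsOutOf≡[ out1 ] vu) (∈-arcsOutOf⁺ vw)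
  ... | here refl = refl

  1≤indeg⇒parent : 1 ≤ indeg G v → ∃ λ u → Arc G u v
  1≤indeg⇒parent {v} 1≤in with arcsInto v (arcs G) in eq
  ... | (u , w) ∷ _ with ∈-arcsInto⁻ {es = arcs G} (subst ((u , w) ∈_) (sym eq) (here refl))
  ...   | uv , refl = u , uv

  indeg≡0⇒no-parent : indeg G v ≡ 0 → ¬ Arc G u v
  indeg≡0⇒no-parent in0 uv with ≤-trans (Arc⇒1≤indeg uv) (≤-reflexive in0)
  ... | ()

  outdeg≡0⇒no-child : outdeg G v ≡ 0 → ¬ Arc G v w
  outdeg≡0⇒no-child out0 vw with ≤-trans (Arc⇒1≤outdeg vw) (≤-reflexive out0)
  ... | ()

  no-parent⇒indeg≡0 : (∀ u → ¬ Arc G u v) → indeg G v ≡ 0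
  no-parent⇒indeg≡0 {v} orphan with arcsInto v (arcs G) in eq
  ... | []          = refl
  ... | (u , w) ∷ _ with ∈-arcsInto⁻ {es = arcs G} (subst ((u , w) ∈_) (sym eq) (here refl))
  ...   | uv , refl = ⊥-elim (orphan u uv)

  two-children⇒2≤outdeg : Arc G v w → Arc G v w′ → w ≢ w′ → 2 ≤ outdeg G v
  two-children⇒2≤outdeg vw vw′ w≢w′ = unique-⊆⇒length≤ (((w≢w′ ∘ cong proj₂) ∷ []) ∷ [] ∷ [])
    λ { (here refl) → ∈-arcsOutOf⁺ vw ; (there (here refl)) → ∈-arcsOutOf⁺ vw′ }

  outdeg≡2⇒no-third-child : outdeg G v ≡ 2 → Arc G v w → Arc G v w′ → w ≢ w′ →
                            Arc G v y → y ≡ w ⊎ y ≡ w′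
  outdeg≡2⇒no-third-child {v} {w} {w′} {y} out2 vw vw′ w≢w′ vy with y ≟ w | y ≟ w′
  ... | yes y≡w | _       = inj₁ y≡w
  ... | no _    | yes y≡w′ = inj₂ y≡w′
  ... | no y≢w  | no y≢w′  = ⊥-elim (n≮n 2 (≤-trans (unique-⊆⇒length≤ distinct children) (≤-reflexive out2)))
    where
    distinct : Unique ((v , w) ∷ (v , w′) ∷ (v , y) ∷ [])
    distinct = ((w≢w′ ∘ cong proj₂) ∷ (y≢w ∘ sym ∘ cong proj₂) ∷ [])
             ∷ ((y≢w′ ∘ sym ∘ cong proj₂) ∷ []) ∷ [] ∷ []
    children : (v , w) ∷ (v , w′) ∷ (v , y) ∷ [] ⊆ arcsOutOf v (arcs G)
    children (here refl)                 = ∈-arcsOutOf⁺ vw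
    children (there (here refl))         = ∈-arcsOutOf⁺ vw′
    children (there (there (here refl))) = ∈-arcsOutOf⁺ vy

suppression : Graph → ℕ → ℕ → ℕ → Graph
suppression G u v w = mkGraph (removeVert v (verts G)) ((u , w) ∷ removeIncident v (arcs G))

module _ {G : Graph} where
  open ≡-Reasoning

  indeg-suppression : x ≢ v → outdeg G v ≡ 1 → Arc G v w → indeg (suppression G u v w) x ≡ indeg G x
  indeg-suppression {x} {v} {w} {u} x≢v out1 vw = begin
    length (arcsInto x ((u , w) ∷ removeIncident v (arcs G)))
      ≡⟨ length-arcsInto-∷ x u v w _ ⟩
    length (arcsInto x [ (v , w) ]) + length (arcsInto x (removeIncident v (arcs G)))
      ≡⟨ cong (λ es → length (arcsInto x es) + length (arcsInto x (removeIncident v (arcs G))))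
              (arcsOutOf≡[_] {G = G} out1 vw) ⟨
    length (arcsInto x (arcsOutOf v (arcs G))) + length (arcsInto x (removeIncident v (arcs G)))
      ≡⟨ length-arcsInto-split x≢v (arcs G) ⟨
    indeg G x ∎

  outdeg-suppression : x ≢ v → indeg G v ≡ 1 → Arc G u v → outdeg (suppression G u v w) x ≡ outdeg G x
  outdeg-suppression {x} {v} {u} {w} x≢v in1 uv = begin
    length (arcsOutOf x ((u , w) ∷ removeIncident v (arcs G)))
      ≡⟨ length-arcsOutOf-∷ x u w v _ ⟩
    length (arcsOutOf x [ (u , v) ]) + length (arcsOutOf x (removeIncident v (arcs G)))
      ≡⟨ cong (λ es → length (arcsOutOf x es) + length (arcsOutOf x (removeIncident v (arcs G))))
              (arcsInto≡[_] {G = G} in1 uv) ⟨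
    length (arcsOutOf x (arcsInto v (arcs G))) + length (arcsOutOf x (removeIncident v (arcs G)))
      ≡⟨ length-arcsOutOf-split x≢v (arcs G) ⟨
    outdeg G x ∎

removeVert-mono : xs ⊆ ys → removeVert v xs ⊆ removeVert v ys
removeVert-mono xs⊆ys x∈ with ∈-removeVert⁻ x∈
... | x∈xs , x≢v = ∈-removeVert⁺ (xs⊆ys x∈xs) x≢v

module _ {G : Graph} where

  ∈-pathVerts-last : (π : Path G u v) → v ∈ pathVerts π
  ∈-pathVerts-last here       = here refl
  ∈-pathVerts-last (step _ π) = there (∈-pathVerts-last π)

  ∈-pathVerts⇒reach-to : (π : Path G u v) → x ∈ pathVerts π → Reach G u x
  ∈-pathVerts⇒reach-to here       (here refl) = here
  ∈-pathVerts⇒reach-to (step _ _) (here refl) = here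
  ∈-pathVerts⇒reach-to (step a π) (there x∈)  = step a (∈-pathVerts⇒reach-to π x∈)

  ∈-pathVerts⇒reach-from : (π : Path G u v) → x ∈ pathVerts π → Reach G x v
  ∈-pathVerts⇒reach-from here       (here refl) = here
  ∈-pathVerts⇒reach-from (step a π) (here refl) = step a π
  ∈-pathVerts⇒reach-from (step _ π) (there x∈)  = ∈-pathVerts⇒reach-from π x∈

  pathVerts-comparable : (π : Path G u v) → x ∈ pathVerts π → y ∈ pathVerts π → Reach G x y ⊎ Reach G y x
  pathVerts-comparable here       (here refl) (here refl) = inj₁ here
  pathVerts-comparable (step a π) (here refl) y∈          = inj₁ (∈-pathVerts⇒reach-to (step a π) y∈)
  pathVerts-comparable (step a π) (there x∈)  (here refl) = inj₂ (∈-pathVerts⇒reach-to (step a π) (there x∈))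
  pathVerts-comparable (step _ π) (there x∈)  (there y∈)  = pathVerts-comparable π x∈ y∈

  path-lastArc : Path G u v → u ≢ v → ∃ λ w → Reach G u w × Arc G w v
  path-lastArc here u≢v = ⊥-elim (u≢v refl)
  path-lastArc {v = v} (step {w = w} a π) u≢v with w ≟ v
  ... | yes refl = _ , here , a
  ... | no w≢v with w′ , π′ , a′ ← path-lastArc π w≢v = w′ , step a π′ , a′

_++ᵖ_ : ∀ {G x y z} → Path G x y → Path G y z → Path G x z
here      ++ᵖ q = q
step a p  ++ᵖ q = step a (p ++ᵖ q)

-- Full simplification is unique up to ≈

record _≈_ (G H : Graph) : Set where
  field
    verts⊆ : verts G ⊆ verts H
    verts⊇ : verts H ⊆ verts G
    arcs↭  : arcs G ↭ arcs H
open _≈_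

≈-mkGraph : ∀ {V V′ es es′} → V ≡ V′ → es ↭ es′ → mkGraph V es ≈ mkGraph V′ es′
≈-mkGraph refl es↭es′ = record { verts⊆ = λ v∈ → v∈ ; verts⊇ = λ v∈ → v∈ ; arcs↭ = es↭es′ }

≈-refl : ∀ {G} → G ≈ G
≈-refl = ≈-mkGraph refl ↭-refl

≈-sym : ∀ {G H} → G ≈ H → H ≈ G
≈-sym G≈H = record { verts⊆ = verts⊇ G≈H ; verts⊇ = verts⊆ G≈H ; arcs↭ = ↭-sym (arcs↭ G≈H) }

≈-trans : ∀ {G H K} → G ≈ H → H ≈ K → G ≈ K
≈-trans G≈H H≈K = record
  { verts⊆ = verts⊆ H≈K ∘ verts⊆ G≈H
  ; verts⊇ = verts⊇ G≈H ∘ verts⊇ H≈K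
  ; arcs↭  = ↭-trans (arcs↭ G≈H) (arcs↭ H≈K)
  }

module _ {G H : Graph} (G≈H : G ≈ H) where

  ≈-arc : Arc G u v → Arc H u v
  ≈-arc = ∈-resp-↭ (arcs↭ G≈H)

  ≈-indeg : ∀ v → indeg G v ≡ indeg H v
  ≈-indeg v = ↭-length (filter-↭ _ (arcs↭ G≈H))

  ≈-outdeg : ∀ v → outdeg G v ≡ outdeg H v
  ≈-outdeg v = ↭-length (filter-↭ _ (arcs↭ G≈H))

Normal : Graph → Set
Normal G = ∀ H → ¬ SimpStep G H

SimpStep-resp-≈ : ∀ {G G′ H} → G ≈ G′ → SimpStep G H → ∃ λ H′ → SimpStep G′ H′ × H ≈ H′
SimpStep-resp-≈ G≈G′ (suppress u v w v∈ in1 out1 uv vw) =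
  _ , suppress u v w (verts⊆ G≈G′ v∈) (trans (sym (≈-indeg G≈G′ v)) in1) (trans (sym (≈-outdeg G≈G′ v)) out1)
                     (≈-arc G≈G′ uv) (≈-arc G≈G′ vw)
    , record { verts⊆ = removeVert-mono (verts⊆ G≈G′)
             ; verts⊇ = removeVert-mono (verts⊇ G≈G′)
             ; arcs↭  = ↭-prep _ (filter-↭ _ (arcs↭ G≈G′)) }
SimpStep-resp-≈ {mkGraph V _} {G′} G≈G′ (dropParallel l₁ e l₂ refl e∈l₁++l₂)
  with ∈-∃++ (≈-arc G≈G′ (∈-++⁺ʳ l₁ (here refl)))
... | n₁ , n₂ , arcs≡ =
  _ , dropParallel n₁ e n₂ arcs≡ (∈-resp-↭ l₁++l₂↭n₁++n₂ e∈l₁++l₂)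
    , record { verts⊆ = verts⊆ G≈G′ ; verts⊇ = verts⊇ G≈G′ ; arcs↭ = l₁++l₂↭n₁++n₂ }
  where
  l₁++l₂↭n₁++n₂ : l₁ ++ l₂ ↭ n₁ ++ n₂
  l₁++l₂↭n₁++n₂ = drop-mid l₁ n₁ (subst (l₁ ++ e ∷ l₂ ↭_) arcs≡ (arcs↭ G≈G′))

SimpStar-resp-≈ : ∀ {G G′ S} → G ≈ G′ → SimpStar G S → ∃ λ S′ → SimpStar G′ S′ × S ≈ S′
SimpStar-resp-≈ G≈G′ done = _ , done , G≈G′
SimpStar-resp-≈ G≈G′ (more s ss) with SimpStep-resp-≈ G≈G′ s
... | H′ , s′ , H≈H′ with SimpStar-resp-≈ H≈H′ ss
... | S′ , ss′ , S≈S′ = S′ , more s′ ss′ , S≈S′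

Normal-resp-≈ : ∀ {G G′} → G ≈ G′ → Normal G → Normal G′
Normal-resp-≈ G≈G′ normal H s with SimpStep-resp-≈ (≈-sym G≈G′) s
... | H′ , s′ , _ = normal H′ s′

record Suppressible (G : Graph) (u v w : ℕ) : Set where
  constructor suppressible
  field
    vertex   : v ∈ verts G
    indeg≡1  : indeg G v ≡ 1
    outdeg≡1 : outdeg G v ≡ 1
    arcIn    : Arc G u v
    arcOut   : Arc G v w
open Suppressible

suppressStep : ∀ {G} → Suppressible G u v w → SimpStep G (suppression G u v w)
suppressStep (suppressible v∈ in1 out1 uv vw) = suppress _ _ _ v∈ in1 out1 uv vw

Joinable : Graph → Graph → Set
Joinable H H′ = H ≈ H′ ⊎ ∃₂ λ K K′ → SimpStep H K × SimpStep H′ K′ × K ≈ K′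

Joinable-sym : ∀ {H H′} → Joinable H H′ → Joinable H′ H
Joinable-sym (inj₁ H≈H′) = inj₁ (≈-sym H≈H′)
Joinable-sym (inj₂ (K , K′ , s , s′ , K≈K′)) = inj₂ (K′ , K , s′ , s , ≈-sym K≈K′)

no-2-cycle : ∀ {G} → Acyclic G → Arc G x y → Arc G y x → ⊥
no-2-cycle acyclic xy yx = acyclic _ _ xy (step yx here)

module _ {G : Graph} where

  Suppressible-suppression : ∀ {a b} → Suppressible G u v w → Suppressible G a v′ b → v′ ≢ v →
    Arc (suppression G u v w) u′ v′ → Arc (suppression G u v w) v′ w′ →
    Suppressible (suppression G u v w) u′ v′ w′
  Suppressible-suppression σ σ′ v′≢v u′v′ v′w′ = suppressible
    (∈-removeVert⁺ (vertex σ′) v′≢v)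
    (trans (indeg-suppression {G = G} v′≢v (outdeg≡1 σ) (arcOut σ)) (indeg≡1 σ′))
    (trans (outdeg-suppression {G = G} v′≢v (indeg≡1 σ) (arcIn σ)) (outdeg≡1 σ′))
    u′v′ v′w′

  suppressions-commute : u ≢ v′ → w ≢ v′ → u′ ≢ v → w′ ≢ v →
    suppression (suppression G u v w) u′ v′ w′ ≈ suppression (suppression G u′ v′ w′) u v w
  suppressions-commute {u} {v′} {w} {u′} {v} {w′} u≢v′ w≢v′ u′≢v w′≢v
    rewrite removeIncident-accept {es = removeIncident v (arcs G)} u≢v′ w≢v′
          | removeIncident-accept {es = removeIncident v′ (arcs G)} u′≢v w′≢v
          | removeIncident-comm v′ v (arcs G)
    = ≈-mkGraph (filterᵇ-comm _ _ (verts G)) (swap _ _ ↭-refl)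

  suppressions-merge : suppression (suppression G u v v′) u v′ w′ ≈ suppression (suppression G v v′ w′) u v w′
  suppressions-merge {u} {v} {v′} {w′}
    rewrite removeIncident-reject {u} {v′} {v′} {removeIncident v (arcs G)} (inj₂ refl)
          | removeIncident-reject {v} {v} {w′} {removeIncident v′ (arcs G)} (inj₁ refl)
          | removeIncident-comm v′ v (arcs G)
    = ≈-mkGraph (filterᵇ-comm _ _ (verts G)) ↭-refl

  adjacent-joinable : Acyclic G → Suppressible G u v v′ → Suppressible G v v′ w′ → v ≢ v′ →
    Joinable (suppression G u v v′) (suppression G v v′ w′)
  adjacent-joinable acyclic σ σ′ v≢v′ = inj₂ (_ , _ ,
      suppressStep (Suppressible-suppression σ σ′ (v≢v′ ∘ sym) (here refl)
                     (there (∈-removeIncident⁺ (arcOut σ′) (v≢v′ ∘ sym)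
                                               (λ { refl → no-2-cycle acyclic (arcIn σ′) (arcOut σ′) })))) ,
      suppressStep (Suppressible-suppression σ′ σ v≢v′
                     (there (∈-removeIncident⁺ (arcIn σ) (λ { refl → no-2-cycle acyclic (arcIn σ) (arcOut σ) }) v≢v′))
                     (here refl)) ,
      suppressions-merge)

  nonadjacent-joinable : Suppressible G u v w → Suppressible G u′ v′ w′ → v ≢ v′ → u′ ≢ v → w′ ≢ v →
    Joinable (suppression G u v w) (suppression G u′ v′ w′)
  nonadjacent-joinable σ σ′ v≢v′ u′≢v w′≢v = inj₂ (_ , _ ,
      suppressStep (Suppressible-suppression σ σ′ (v≢v′ ∘ sym)
                     (there (∈-removeIncident⁺ (arcIn σ′) u′≢v (v≢v′ ∘ sym)))
                     (there (∈-removeIncident⁺ (arcOut σ′) (v≢v′ ∘ sym) w′≢v))) ,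
      suppressStep (Suppressible-suppression σ′ σ v≢v′
                     (there (∈-removeIncident⁺ (arcIn σ) u≢v′ v≢v′))
                     (there (∈-removeIncident⁺ (arcOut σ) v≢v′ w≢v′))) ,
      suppressions-commute u≢v′ w≢v′ u′≢v w′≢v)
    where
    u≢v′ : _ ≢ _
    u≢v′ refl = w′≢v (outdeg≡1⇒child-unique {G = G} (outdeg≡1 σ′) (arcOut σ′) (arcIn σ))
    w≢v′ : _ ≢ _
    w≢v′ refl = u′≢v (indeg≡1⇒parent-unique {G = G} (indeg≡1 σ′) (arcIn σ′) (arcOut σ))

  suppressions-joinable : Acyclic G → Suppressible G u v w → Suppressible G u′ v′ w′ →
    Joinable (suppression G u v w) (suppression G u′ v′ w′)
  suppressions-joinable {u} {v} {w} {u′} {v′} {w′} acyclic σ σ′ with v ≟ v′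
  ... | yes refl
    with refl ← indeg≡1⇒parent-unique {G = G} (indeg≡1 σ) (arcIn σ) (arcIn σ′)
       | refl ← outdeg≡1⇒child-unique {G = G} (outdeg≡1 σ) (arcOut σ) (arcOut σ′) = inj₁ ≈-refl
  ... | no v≢v′ with u′ ≟ v | w′ ≟ v
  ... | yes refl | _
    with refl ← outdeg≡1⇒child-unique {G = G} (outdeg≡1 σ) (arcOut σ) (arcIn σ′) =
      adjacent-joinable acyclic σ σ′ v≢v′
  ... | no _ | yes refl
    with refl ← indeg≡1⇒parent-unique {G = G} (indeg≡1 σ) (arcIn σ) (arcOut σ′) =
      Joinable-sym (adjacent-joinable acyclic σ′ σ (v≢v′ ∘ sym))
  ... | no u′≢v | no w′≢v = nonadjacent-joinable σ σ′ v≢v′ u′≢v w′≢v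

module _ {V : List ℕ} {l₁ l₂ : ArcList} {e₁ e₂ : ℕ} (e∈ : (e₁ , e₂) ∈ l₁ ++ l₂) where
  private
    G = mkGraph V (l₁ ++ (e₁ , e₂) ∷ l₂)

  parallel-head : indeg G v ≡ 1 → e₂ ≢ v
  parallel-head {v} in1 refl
    with ≤-trans (length-filterᵇ-duplicate _ l₁ l₂ e∈ (≡⇒eqᵇ {e₂} refl)) (≤-reflexive in1)
  ... | s≤s ()

  parallel-tail : outdeg G v ≡ 1 → e₁ ≢ v
  parallel-tail {v} out1 refl
    with ≤-trans (length-filterᵇ-duplicate _ l₁ l₂ e∈ (≡⇒eqᵇ {e₁} refl)) (≤-reflexive out1)
  ... | s≤s ()

  suppression-drop-joinable : Suppressible G u v w → Joinable (suppression G u v w) (mkGraph V (l₁ ++ l₂))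
  suppression-drop-joinable {u} {v} {w} (suppressible v∈ in1 out1 uv vw) = inj₂ (_ , _ ,
      dropParallel ((u , w) ∷ removeIncident v l₁) e (removeIncident v l₂) (cong ((u , w) ∷_) split) e∈′ ,
      suppress u v w v∈
        (trans (sym (length-filterᵇ-delete _ l₁ l₂ (e₂≢v ∘ eqᵇ⇒≡))) in1)
        (trans (sym (length-filterᵇ-delete _ l₁ l₂ (e₁≢v ∘ eqᵇ⇒≡))) out1)
        (∈-++-delete l₁ l₂ uv (λ eq → e₂≢v (sym (cong proj₂ eq))))
        (∈-++-delete l₁ l₂ vw (λ eq → e₁≢v (sym (cong proj₁ eq)))) ,
      ≈-mkGraph refl (↭-reflexive (cong ((u , w) ∷_) (sym (filter-++ _ l₁ l₂)))))
    where
    e = (e₁ , e₂)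
    e₂≢v = parallel-head in1
    e₁≢v = parallel-tail out1
    split : removeIncident v (l₁ ++ e ∷ l₂) ≡ removeIncident v l₁ ++ e ∷ removeIncident v l₂
    split = trans (filter-++ _ l₁ (e ∷ l₂)) (cong (removeIncident v l₁ ++_) (removeIncident-accept e₁≢v e₂≢v))
    e∈′ : e ∈ ((u , w) ∷ removeIncident v l₁) ++ removeIncident v l₂
    e∈′ = there (subst (e ∈_) (filter-++ _ l₁ l₂) (∈-removeIncident⁺ e∈ e₁≢v e₂≢v))

drops-joinable : ∀ {V} {l₁ l₂ m₁ m₂ : ArcList} {e f} → l₁ ++ e ∷ l₂ ≡ m₁ ++ f ∷ m₂ →
  e ∈ l₁ ++ l₂ → f ∈ m₁ ++ m₂ → Joinable (mkGraph V (l₁ ++ l₂)) (mkGraph V (m₁ ++ m₂))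
drops-joinable {l₁ = l₁} {l₂} {m₁} {m₂} {e} {f} eq e∈l f∈m with ≡-dec _≟_ _≟_ e f
... | yes refl = inj₁ (≈-mkGraph refl (drop-mid-≡ l₁ m₁ eq))
... | no e≢f with ∈-∃++ (∈-++-delete l₁ _ (subst (f ∈_) (sym eq) (∈-++⁺ʳ m₁ (here refl))) (e≢f ∘ sym))
... | n₁ , n₂ , l≡n = inj₂ (_ , _ ,
    dropParallel n₁ f n₂ l≡n f∈n , dropParallel n₁′ e n₂′ m≡n′ e∈n′ , ≈-mkGraph refl (↭-sym n′↭n))
  where
  open PermutationReasoning
  m↭ : m₁ ++ m₂ ↭ e ∷ n₁ ++ n₂
  m↭ = drop-mid m₁ [] (begin
    m₁ ++ f ∷ m₂      ≡⟨ eq ⟨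
    l₁ ++ e ∷ l₂      ↭⟨ shift e l₁ l₂ ⟩
    e ∷ l₁ ++ l₂      ≡⟨ cong (e ∷_) l≡n ⟩
    e ∷ n₁ ++ f ∷ n₂  ↭⟨ ↭-prep e (shift f n₁ n₂) ⟩
    e ∷ f ∷ n₁ ++ n₂  ↭⟨ swap e f ↭-refl ⟩
    f ∷ e ∷ n₁ ++ n₂  ∎)
  f∈n : f ∈ n₁ ++ n₂
  f∈n with ∈-resp-↭ m↭ f∈m
  ... | here f≡e  = ⊥-elim (e≢f (sym f≡e))
  ... | there f∈n = f∈n
  n′ = ∈-∃++ (∈-resp-↭ (↭-sym m↭) (here refl))
  n₁′ = proj₁ n′
  n₂′ = proj₁ (proj₂ n′)
  m≡n′ : m₁ ++ m₂ ≡ n₁′ ++ e ∷ n₂′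
  m≡n′ = proj₂ (proj₂ n′)
  n′↭n : n₁′ ++ n₂′ ↭ n₁ ++ n₂
  n′↭n = drop-mid n₁′ [] (subst (_↭ e ∷ n₁ ++ n₂) m≡n′ m↭)
  e∈n′ : e ∈ n₁′ ++ n₂′
  e∈n′ = ∈-resp-↭ (↭-sym n′↭n) (∈-++-delete n₁ n₂ (subst (e ∈_) l≡n e∈l) e≢f)

locally-confluent : ∀ {G H H′} → Acyclic G → SimpStep G H → SimpStep G H′ → Joinable H H′
locally-confluent acyclic (suppress _ _ _ v∈ in1 out1 uv vw) (suppress _ _ _ v∈′ in1′ out1′ uv′ vw′) =
  suppressions-joinable acyclic (suppressible v∈ in1 out1 uv vw) (suppressible v∈′ in1′ out1′ uv′ vw′)
locally-confluent {mkGraph _ _} _ (suppress _ _ _ v∈ in1 out1 uv vw) (dropParallel _ (_ , _) _ refl e∈) =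
  suppression-drop-joinable e∈ (suppressible v∈ in1 out1 uv vw)
locally-confluent {mkGraph _ _} _ (dropParallel _ (_ , _) _ refl e∈) (suppress _ _ _ v∈ in1 out1 uv vw) =
  Joinable-sym (suppression-drop-joinable e∈ (suppressible v∈ in1 out1 uv vw))
locally-confluent {mkGraph _ _} _ (dropParallel _ _ _ refl e∈) (dropParallel _ _ _ eq f∈) =
  drops-joinable eq e∈ f∈

SimpStep-arc : ∀ {G H} → SimpStep G H → Arc H x y → ∃ λ z → Arc G x z × Reach G z y
SimpStep-arc (suppress _ v _ _ _ _ uv vw) (here refl) = v , uv , step vw here
SimpStep-arc (suppress _ _ _ _ _ _ _ _) (there a) = _ , proj₁ (∈-removeIncident⁻ a) , here
SimpStep-arc {G = mkGraph _ _} (dropParallel l₁ _ _ refl _) a = _ , ∈-++-insert l₁ _ a , here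

SimpStep-reach : ∀ {G H} → SimpStep G H → Reach H x y → Reach G x y
SimpStep-reach s here = here
SimpStep-reach s (step a p) with SimpStep-arc s a
... | _ , a′ , q = step a′ (q ++ᵖ SimpStep-reach s p)

SimpStep-acyclic : ∀ {G H} → Acyclic G → SimpStep G H → Acyclic H
SimpStep-acyclic acyclic s x y a p with SimpStep-arc s a
... | _ , a′ , q = acyclic x _ a′ (q ++ᵖ SimpStep-reach s p)

strip : ∀ {G H S} → Acyclic G → SimpStep G H → SimpStar G S → Normal S →
        ∃ λ S′ → SimpStar H S′ × S′ ≈ S
strip _ s done normal = ⊥-elim (normal _ s)
strip acyclic s (more s₁ ss) normal with locally-confluent acyclic s s₁
... | inj₁ H≈H₁ with SimpStar-resp-≈ (≈-sym H≈H₁) ss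
...   | S′ , ss′ , S≈S′ = S′ , ss′ , ≈-sym S≈S′
strip acyclic s (more s₁ ss) normal | inj₂ (K , K₁ , sK , sK₁ , K≈K₁)
  with S₁ , ss₁ , S₁≈S ← strip (SimpStep-acyclic acyclic s₁) sK₁ ss normal
  with S′ , ss′ , S₁≈S′ ← SimpStar-resp-≈ (≈-sym K≈K₁) ss₁
  = S′ , more sK ss′ , ≈-trans (≈-sym S₁≈S′) S₁≈S

simplification-unique : ∀ {G S T} → Acyclic G → SimpStar G S → Normal S → SimpStar G T → Normal T → S ≈ T
simplification-unique _ done _ done _ = ≈-refl
simplification-unique _ done normalS (more s _) _ = ⊥-elim (normalS _ s)
simplification-unique acyclic (more s ss) normalS tt normalT
  with T′ , tt′ , T′≈T ← strip acyclic s tt normalT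
  = ≈-trans (simplification-unique (SimpStep-acyclic acyclic s) ss normalS tt′ (Normal-resp-≈ (≈-sym T′≈T) normalT))
            T′≈T

_⇝≈_ : Graph → Graph → Set
G ⇝≈ H = G ≈ H ⊎ ∃ λ K → SimpStep G K × K ≈ H

fullSimplification-resp-⇝≈ : ∀ {G H S T} → Acyclic G → G ⇝≈ H →
  IsFullSimplification G S → IsFullSimplification H T → S ≈ T
fullSimplification-resp-⇝≈ acyclic (inj₁ G≈H) (ss , normalS) (tt , normalT)
  with T′ , tt′ , T≈T′ ← SimpStar-resp-≈ (≈-sym G≈H) tt
  = ≈-trans (simplification-unique acyclic ss normalS tt′ (Normal-resp-≈ T≈T′ normalT)) (≈-sym T≈T′)
fullSimplification-resp-⇝≈ acyclic (inj₂ (K , s , K≈H)) (ss , normalS) (tt , normalT)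
  with T′ , tt′ , T≈T′ ← SimpStar-resp-≈ (≈-sym K≈H) tt
  = ≈-trans (simplification-unique acyclic ss normalS (more s tt′) (Normal-resp-≈ T≈T′ normalT)) (≈-sym T≈T′)

module BinaryNetwork {G : Graph} {X : List ℕ} (N : IsBigNetwork G X) where
  open IsBigNetwork N

  isRoot : IsRoot G root
  isRoot = record { root∈ = root∈ ; rootIn0 = rootIn }

  nonroot-parent : v ∈ verts G → v ≢ root → ∃ λ u → Arc G u v
  nonroot-parent v∈ v≢root with others _ v∈ v≢root
  ... | inj₁ (_ , in1 , _)        = 1≤indeg⇒parent {G = G} (≤-reflexive (sym in1))
  ... | inj₂ (inj₁ (_ , in1 , _)) = 1≤indeg⇒parent {G = G} (≤-reflexive (sym in1))
  ... | inj₂ (inj₂ (_ , in2 , _)) = 1≤indeg⇒parent {G = G} (≤-trans (s≤s z≤n) (≤-reflexive (sym in2)))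

  root-unique : ∀ {ρ} → IsRoot G ρ → ρ ≡ root
  root-unique {ρ} ρ-root with ρ ≟ root
  ... | yes ρ≡root = ρ≡root
  ... | no ρ≢root with _ , uρ ← nonroot-parent (IsRoot.root∈ ρ-root) ρ≢root =
    ⊥-elim (indeg≡0⇒no-parent {G = G} (IsRoot.rootIn0 ρ-root) uρ)

  leaf≢root : x ∈ X → x ≢ root
  leaf≢root x∈X refl = rootNotLeaf x∈X

  leaf-degrees : x ∈ X → indeg G x ≡ 1 × outdeg G x ≡ 0
  leaf-degrees x∈X with others _ (leaves⊆ _ x∈X) (leaf≢root x∈X)
  ... | inj₁ (_ , degrees)        = degrees
  ... | inj₂ (inj₁ (x∉X , _))     = ⊥-elim (x∉X x∈X)
  ... | inj₂ (inj₂ (x∉X , _))     = ⊥-elim (x∉X x∈X)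

  leaf-childless : x ∈ X → ¬ Arc G x y
  leaf-childless x∈X = outdeg≡0⇒no-child {G = G} (proj₂ (leaf-degrees x∈X))

  leaf-descendant : x ∈ X → Reach G x y → y ≡ x
  leaf-descendant x∈X here       = refl
  leaf-descendant x∈X (step xz _) = ⊥-elim (leaf-childless x∈X xz)

  two-children : Arc G v w → Arc G v w′ → w ≢ w′ → outdeg G v ≡ 2 × (v ≢ root → indeg G v ≡ 1)
  two-children {v} vw vw′ w≢w′ with v ≟ root
  ... | yes refl = rootOut , λ v≢root → ⊥-elim (v≢root refl)
  ... | no v≢root with others v (proj₁ (arcsWF _ _ vw)) v≢root
  ... | inj₁ (_ , _ , out0)         = ⊥-elim (outdeg≡0⇒no-child {G = G} out0 vw)
  ... | inj₂ (inj₁ (_ , in1 , out2)) = out2 , λ _ → in1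
  ... | inj₂ (inj₂ (_ , _ , out1))  with ≤-trans (two-children⇒2≤outdeg {G = G} vw vw′ w≢w′) (≤-reflexive out1)
  ...   | s≤s ()

  -- Walking back along parents keeps the path simple (by acyclicity), so the root is reached
  -- within |V| steps.
  private
    walk-back : ∀ k {w} → w ∈ verts G → (π : Path G w v) → Unique (pathVerts π) → pathVerts π ⊆ verts G →
                length (verts G) < length (pathVerts π) + k → Reach G root v
    walk-back zero w∈ π uπ π⊆ long = ⊥-elim (n≮n _ (<-≤-trans long
      (≤-trans (≤-reflexive (+-identityʳ _)) (unique-⊆⇒length≤ uπ π⊆))))
    walk-back (suc k) {w} w∈ π uπ π⊆ long with w ≟ root
    ... | yes refl = π
    ... | no w≢root with y , yw ← nonroot-parent w∈ w≢root =
      walk-back k y∈ (step yw π) (¬Any⇒All¬ _ y∉π ∷ uπ) (λ { (here refl) → y∈ ; (there z∈) → π⊆ z∈ })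
                (<-≤-trans long (≤-reflexive (+-suc _ k)))
      where
      y∈ = proj₁ (arcsWF y w yw)
      y∉π : y ∉ pathVerts π
      y∉π y∈π = acyclic y w yw (∈-pathVerts⇒reach-to π y∈π)

  reach-from-root : v ∈ verts G → Reach G root v
  reach-from-root v∈ = walk-back _ v∈ here ([] ∷ []) (λ { (here refl) → v∈ }) ≤-refl

  stableAncestor-reaches : ∀ {A s} → StableAncestor G A s → x ∈ A → x ∈ X → Reach G s x
  stableAncestor-reaches (_ , stable) x∈A x∈X =
    ∈-pathVerts⇒reach-from π (stable root isRoot _ x∈A π)
    where π = reach-from-root (leaves⊆ _ x∈X)

-- Path graphs

module PathGraph {H : Graph} {A : List ℕ} {u : ℕ} {P : Graph} (pg : IsPathGraph H A u P) where
  open IsPathGraph pg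

  vertex⁻ : v ∈ verts P → v ∈ verts H × OnPathToA H u A v
  vertex⁻ = Equivalence.to (vertsC _)

  vertex⁺ : v ∈ verts H → Reach H u v → x ∈ A → Reach H v x → v ∈ verts P
  vertex⁺ v∈ uv x∈A vx = Equivalence.from (vertsC _) (v∈ , uv , _ , x∈A , vx)

  arc⁻ : (v , w) ∈ arcs P → Arc H v w × Reach H u v × ∃ λ x → x ∈ A × Reach H w x
  arc⁻ = Equivalence.to (arcsC _ _)

  arc⁺ : Arc H v w → Reach H u v → x ∈ A → Reach H w x → (v , w) ∈ arcs P
  arc⁺ vw uv x∈A wx = Equivalence.from (arcsC _ _) (vw , uv , _ , x∈A , wx)

  reach : Reach P v w → Reach H v w
  reach here       = here
  reach (step a π) = step (proj₁ (arc⁻ a)) (reach π)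

  acyclic : Acyclic H → Acyclic P
  acyclic acyclicH v w vw wv = acyclicH v w (proj₁ (arc⁻ vw)) (reach wv)

pathGraphs-≈ : ∀ {H H′ A A′ u u′ P P′} → IsPathGraph H A u P → IsPathGraph H′ A′ u′ P′ →
  verts P ⊆ verts P′ → verts P′ ⊆ verts P → arcs P ⊆ arcs P′ → arcs P′ ⊆ arcs P → P ≈ P′
pathGraphs-≈ pg pg′ V⊆ V⊇ E⊆ E⊇ = record
  { verts⊆ = V⊆ ; verts⊇ = V⊇ ; arcs↭ = unique-⊆⇒↭ (IsPathGraph.arcsU pg) (IsPathGraph.arcsU pg′) E⊆ E⊇ }

pathGraphs-[]-≈ : ∀ {H H′ u u′ P P′} → IsPathGraph H [] u P → IsPathGraph H′ [] u′ P′ → P ≈ P′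
pathGraphs-[]-≈ pg pg′ = pathGraphs-≈ pg pg′
  (λ v∈ → absurd (proj₂ (proj₂ (PathGraph.vertex⁻ pg v∈))))
  (λ v∈ → absurd (proj₂ (proj₂ (PathGraph.vertex⁻ pg′ v∈))))
  (λ { {_ , _} e∈ → absurd (proj₂ (proj₂ (PathGraph.arc⁻ pg e∈))) })
  (λ { {_ , _} e∈ → absurd (proj₂ (proj₂ (PathGraph.arc⁻ pg′ e∈))) })
  where
  absurd : ∀ {B : Set} {Q : ℕ → Set} → ∃ (λ x → x ∈ [] × Q x) → B
  absurd (_ , () , _)

-- Reducing a leaf of a cherry

module CherryReduction {G : Graph} {X : List ℕ} (N : IsBigNetwork G X) {a b p : ℕ}
              (a∈X : a ∈ X) (b∈X : b ∈ X) (a≢b : a ≢ b) (pa : Arc G p a) (pb : Arc G p b) where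
  open IsBigNetwork N
  open BinaryNetwork N public

  p∉X : p ∉ X
  p∉X p∈X = leaf-childless p∈X pa

  leaf≢p : x ∈ X → x ≢ p
  leaf≢p x∈X refl = p∉X x∈X

  p∈V : p ∈ verts G
  p∈V = proj₁ (arcsWF p a pa)

  p-child : Arc G p y → y ≡ a ⊎ y ≡ b
  p-child = outdeg≡2⇒no-third-child {G = G} (proj₁ (two-children pa pb a≢b)) pa pb a≢b

  p-descendant : Reach G p y → y ≡ p ⊎ y ≡ a ⊎ y ≡ b
  p-descendant here = inj₁ refl
  p-descendant (step pz π) with p-child pz
  ... | inj₁ refl = inj₂ (inj₁ (leaf-descendant a∈X π))
  ... | inj₂ refl = inj₂ (inj₂ (leaf-descendant b∈X π))

  ancestor≢b : Reach G v w → w ≢ b → v ≢ b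
  ancestor≢b π w≢b refl = w≢b (leaf-descendant b∈X π)

  module Leaves {A : List ℕ} (A⊆X∖b : All (λ x → x ∈ X × x ≢ b) A) where

    A⊆X : x ∈ A → x ∈ X
    A⊆X = proj₁ ∘ All.lookup A⊆X∖b

    A∌b : x ∈ A → x ≢ b
    A∌b = proj₂ ∘ All.lookup A⊆X∖b

    p-descendant-in-A : x ∈ A → Reach G p x → x ≡ a
    p-descendant-in-A x∈A px with p-descendant px
    ... | inj₁ x≡p        = ⊥-elim (leaf≢p (A⊆X x∈A) x≡p)
    ... | inj₂ (inj₁ x≡a) = x≡a
    ... | inj₂ (inj₂ x≡b) = ⊥-elim (A∌b x∈A x≡b)

    a-stable : (∀ {x} → x ∈ A → x ≡ a) → StableAncestor G A a
    a-stable A≡a = leaves⊆ a a∈X , λ _ _ x x∈A π → subst (_∈ pathVerts π) (A≡a x∈A) (∈-pathVerts-last π)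

    atRoot-pathGraphs-≈ : ∀ {x₀ u u′ P P′} → indeg G p ≡ 0 → x₀ ∈ A →
      IsLsa G A u → IsLsa (singleVertex a) A u′ →
      IsPathGraph G A u P → IsPathGraph (singleVertex a) A u′ P′ → P ≈ P′
    atRoot-pathGraphs-≈ {x₀} {u} {u′} {P} {P′} p-in0 x₀∈A (u-stable , u-lowest) ((u′∈ , _) , _) pg pg′ =
      pathGraphs-≈ pg pg′
        (λ v∈ → subst (_∈ verts P′) (sym (P∋⇒≡a v∈)) a∈P′) (λ v∈ → subst (_∈ verts P) (sym (P′∋⇒≡a v∈)) a∈P)
        (λ { {v , w} e∈ → ⊥-elim (P-arcless e∈) }) (λ { {v , w} e∈ → ⊥-elim (P′-arcless e∈) })
      where
      module P = PathGraph pg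
      module P′ = PathGraph pg′
      A∋⇒≡a : x ∈ A → x ≡ a
      A∋⇒≡a x∈A = p-descendant-in-A x∈A (subst (λ r → Reach G r _)
        (sym (root-unique (record { root∈ = p∈V ; rootIn0 = p-in0 })))
        (reach-from-root (leaves⊆ _ (A⊆X x∈A))))
      x₀≡a = A∋⇒≡a x₀∈A
      u⇝a : Reach G u a
      u⇝a = subst (Reach G u) x₀≡a (stableAncestor-reaches u-stable x₀∈A (A⊆X x₀∈A))
      u≡a : u ≡ a
      u≡a = sym (u-lowest a (a-stable A∋⇒≡a) u⇝a)
      P∋⇒≡a : v ∈ verts P → v ≡ a
      P∋⇒≡a v∈ = leaf-descendant a∈X (subst (λ r → Reach G r _) u≡a (proj₁ (proj₂ (P.vertex⁻ v∈))))
      a∈P : a ∈ verts P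
      a∈P = P.vertex⁺ (leaves⊆ a a∈X) u⇝a x₀∈A (subst (Reach G a) (sym x₀≡a) here)
      P-arcless : ¬ (v , w) ∈ arcs P
      P-arcless e∈ with vw , uv , _ ← P.arc⁻ e∈ =
        leaf-childless a∈X (subst (λ r → Arc G r _) (leaf-descendant a∈X (subst (λ r → Reach G r _) u≡a uv)) vw)
      P′∋⇒≡a : v ∈ verts P′ → v ≡ a
      P′∋⇒≡a = singleton⁻ ∘ proj₁ ∘ P′.vertex⁻
      a∈P′ : a ∈ verts P′
      a∈P′ = P′.vertex⁺ (here refl) (subst (λ r → Reach (singleVertex a) r a) (sym (singleton⁻ u′∈)) here) x₀∈A
                        (subst (Reach (singleVertex a) a) (sym x₀≡a) here)
      P′-arcless : ¬ (v , w) ∈ arcs P′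
      P′-arcless e∈ with () ← proj₁ (P′.arc⁻ e∈)

  module Inner {q : ℕ} (qp : Arc G q p) where

    G′ : Graph
    G′ = mkGraph (removeVert p (removeVert b (verts G))) ((q , a) ∷ removeIncident p (removeIncident b (arcs G)))

    p≢root : p ≢ root
    p≢root refl = indeg≡0⇒no-parent {G = G} rootIn qp

    p-parent : Arc G y p → y ≡ q
    p-parent yp = indeg≡1⇒parent-unique {G = G} (proj₂ (two-children pa pb a≢b) p≢root) yp qp

    a≢p : a ≢ p
    a≢p = leaf≢p a∈X

    q≢p : q ≢ p
    q≢p refl = acyclic q q qp here

    q≢b : q ≢ b
    q≢b refl = leaf-childless b∈X qp

    ¬qa : ¬ Arc G q a
    ¬qa qa = q≢p (indeg≡1⇒parent-unique {G = G} (proj₁ (leaf-degrees a∈X)) qa pa)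

    vertex′⁻ : v ∈ verts G′ → v ∈ verts G × v ≢ b × v ≢ p
    vertex′⁻ v∈ with v∈′ , v≢p ← ∈-removeVert⁻ v∈ with v∈G , v≢b ← ∈-removeVert⁻ v∈′ =
      v∈G , v≢b , v≢p

    vertex′⁺ : v ∈ verts G → v ≢ b → v ≢ p → v ∈ verts G′
    vertex′⁺ v∈ v≢b v≢p = ∈-removeVert⁺ (∈-removeVert⁺ v∈ v≢b) v≢p

    arc′⁻ : Arc G′ v w → (v ≡ q × w ≡ a) ⊎ (Arc G v w × v ≢ p × w ≢ p × v ≢ b × w ≢ b)
    arc′⁻ (here refl) = inj₁ (refl , refl)
    arc′⁻ (there e∈) with e∈′ , v≢p , w≢p ← ∈-removeIncident⁻ e∈
                     with vw , v≢b , w≢b ← ∈-removeIncident⁻ e∈′ =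
      inj₂ (vw , v≢p , w≢p , v≢b , w≢b)

    arc′⁺ : Arc G v w → v ≢ p → w ≢ p → v ≢ b → w ≢ b → Arc G′ v w
    arc′⁺ vw v≢p w≢p v≢b w≢b = there (∈-removeIncident⁺ (∈-removeIncident⁺ vw v≢b w≢b) v≢p w≢p)

    lift : (π′ : Path G′ v w) →
           Σ (Path G v w) λ π → ∀ {s} → s ∈ pathVerts π → s ≢ p → s ∈ pathVerts π′
    lift here = here , λ s∈ _ → s∈
    lift (step e π′) with arc′⁻ e | lift π′
    ... | inj₁ (refl , refl) | π , π⊆ = step qp (step pa π) , λ
      { (here refl)         _   → here refl
      ; (there (here refl)) s≢p → ⊥-elim (s≢p refl)
      ; (there (there s∈))  s≢p → there (π⊆ s∈ s≢p) }
    ... | inj₂ (vw , _) | π , π⊆ =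
      step vw π , λ { (here refl) _ → here refl ; (there s∈) s≢p → there (π⊆ s∈ s≢p) }

    lift-reach : Reach G′ v w → Reach G v w
    lift-reach = proj₁ ∘ lift

    lower : (π : Path G v w) → v ≢ p → v ≢ b → w ≢ p → w ≢ b →
            Σ (Path G′ v w) λ π′ → pathVerts π′ ⊆ pathVerts π
    lower here _ _ _ _ = here , λ s∈ → s∈
    lower (step {w = z} vz π) v≢p v≢b w≢p w≢b with z ≟ p
    ... | no z≢p with π′ , π′⊆ ← lower π z≢p (ancestor≢b π w≢b) w≢p w≢b =
      step (arc′⁺ vz v≢p z≢p v≢b (ancestor≢b π w≢b)) π′ ,
      λ { (here refl) → here refl ; (there s∈) → there (π′⊆ s∈) }
    lower (step _ here) _ _ w≢p _ | yes refl = ⊥-elim (w≢p refl)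
    lower (step vp (step pz π)) _ _ w≢p w≢b | yes refl with p-child pz
    ... | inj₂ refl = ⊥-elim (w≢b (leaf-descendant b∈X π))
    ... | inj₁ refl with refl ← p-parent vp with π′ , π′⊆ ← lower π a≢p a≢b w≢p w≢b =
      step (here refl) π′ , λ { (here refl) → here refl ; (there s∈) → there (there (π′⊆ s∈)) }

    lower-reach : Reach G v w → v ≢ p → v ≢ b → w ≢ p → w ≢ b → Reach G′ v w
    lower-reach π v≢p v≢b w≢p w≢b = proj₁ (lower π v≢p v≢b w≢p w≢b)

    parent′ : Arc G y v → v ≢ b → v ≢ p → ∃ λ y′ → Arc G′ y′ v
    parent′ {y} yv v≢b v≢p with y ≟ p
    ... | yes refl with p-child yv
    ...   | inj₁ refl = q , here refl
    ...   | inj₂ v≡b  = ⊥-elim (v≢b v≡b)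
    parent′ {y} yv v≢b v≢p | no y≢p = y , arc′⁺ yv y≢p v≢p (λ { refl → leaf-childless b∈X yv }) v≢b

    root′-unique : ∀ {ρ} → IsRoot G′ ρ → ρ ≡ root
    root′-unique {ρ} ρ-root with ρ ≟ root
    ... | yes ρ≡root = ρ≡root
    ... | no ρ≢root with ρ∈ , ρ≢b , ρ≢p ← vertex′⁻ (IsRoot.root∈ ρ-root)
                    with _ , yρ ← nonroot-parent ρ∈ ρ≢root =
      ⊥-elim (indeg≡0⇒no-parent {G = G′} (IsRoot.rootIn0 ρ-root) (proj₂ (parent′ yρ ρ≢b ρ≢p)))

    isRoot′ : IsRoot G′ root
    isRoot′ = record
      { root∈   = vertex′⁺ root∈ (leaf≢root b∈X ∘ sym) (p≢root ∘ sym)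
      ; rootIn0 = no-parent⇒indeg≡0 {G = G′} orphan }
      where
      orphan : ∀ y → ¬ Arc G′ y root
      orphan y yr with arc′⁻ yr
      ... | inj₁ (_ , root≡a) = leaf≢root a∈X (sym root≡a)
      ... | inj₂ (yr′ , _)    = indeg≡0⇒no-parent {G = G} rootIn yr′

    module OnLeaves {A : List ℕ} (A⊆X∖b : All (λ x → x ∈ X × x ≢ b) A) where
      open Leaves A⊆X∖b

      stable⇒stable′ : ∀ {s} → StableAncestor G A s → s ≢ p → s ≢ b → StableAncestor G′ A s
      stable⇒stable′ {s} (s∈ , stable) s≢p s≢b = vertex′⁺ s∈ s≢b s≢p , stable′
        where
        stable′ : ∀ ρ → IsRoot G′ ρ → ∀ x → x ∈ A → (π′ : Path G′ ρ x) → s ∈ pathVerts π′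
        stable′ ρ ρ-root x x∈A π′ with refl ← root′-unique ρ-root with π , π⊆ ← lift π′ =
          π⊆ (stable root isRoot x x∈A π) s≢p

      stable′⇒stable : ∀ {s} → StableAncestor G′ A s → StableAncestor G A s
      stable′⇒stable {s} (s∈ , stable′) = proj₁ (vertex′⁻ s∈) , stable
        where
        stable : ∀ ρ → IsRoot G ρ → ∀ x → x ∈ A → (π : Path G ρ x) → s ∈ pathVerts π
        stable ρ ρ-root x x∈A π with refl ← root-unique ρ-root
          with π′ , π′⊆ ← lower π (p≢root ∘ sym) (leaf≢root b∈X ∘ sym) (leaf≢p (A⊆X x∈A)) (A∌b x∈A) =
          π′⊆ (stable′ root isRoot′ x x∈A π′)

      module Lsa {u : ℕ} (lsa : IsLsa G A u) {x₀ : ℕ} (x₀∈A : x₀ ∈ A) where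

        u⇝ : x ∈ A → Reach G u x
        u⇝ x∈A = stableAncestor-reaches (proj₁ lsa) x∈A (A⊆X x∈A)

        u≢b : u ≢ b
        u≢b = ancestor≢b (u⇝ x₀∈A) (A∌b x₀∈A)

        -- If u were p, every leaf of A would be a, making a a lower stable ancestor.
        u≢p : u ≢ p
        u≢p refl = a≢p (proj₂ lsa a (a-stable (λ x∈A → p-descendant-in-A x∈A (u⇝ x∈A))) (step pa here))

        lsa-unique : ∀ {u′} → IsLsa G′ A u′ → u ≡ u′
        lsa-unique {u′} lsa′@((u′∈ , _) , _)
          with pathVerts-comparable π₀ (proj₂ (proj₁ lsa) root isRoot x₀ x₀∈A π₀)
                                       (proj₂ (stable′⇒stable (proj₁ lsa′)) root isRoot x₀ x₀∈A π₀)
          where π₀ = reach-from-root (leaves⊆ x₀ (A⊆X x₀∈A))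
        ... | inj₁ u⇝u′ = sym (proj₂ lsa u′ (stable′⇒stable (proj₁ lsa′)) u⇝u′)
        ... | inj₂ u′⇝u with _ , u′≢b , u′≢p ← vertex′⁻ u′∈ =
          proj₂ lsa′ u (stable⇒stable′ (proj₁ lsa) u≢p u≢b) (lower-reach u′⇝u u′≢p u′≢b u≢p u≢b)

        module _ {P P′ : Graph} (pg : IsPathGraph G A u P) (pg′ : IsPathGraph G′ A u P′) where
          private
            module P  = PathGraph pg
            module P′ = PathGraph pg′

          vertex⇒vertex′ : v ∈ verts P → v ≢ p → v ∈ verts P′
          vertex⇒vertex′ v∈ v≢p with v∈G , uv , x , x∈A , vx ← P.vertex⁻ v∈ =
            P′.vertex⁺ (vertex′⁺ v∈G v≢b v≢p) (lower-reach uv u≢p u≢b v≢p v≢b) x∈A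
                       (lower-reach vx v≢p v≢b (leaf≢p (A⊆X x∈A)) (A∌b x∈A))
            where v≢b = ancestor≢b vx (A∌b x∈A)

          vertex′⇒vertex : v ∈ verts P′ → v ∈ verts P × v ≢ p
          vertex′⇒vertex v∈ with v∈′ , uv , x , x∈A , vx ← P′.vertex⁻ v∈
                            with v∈G , _ , v≢p ← vertex′⁻ v∈′ =
            P.vertex⁺ v∈G (lift-reach uv) x∈A (lift-reach vx) , v≢p

          arc⇒arc′ : (v , w) ∈ arcs P → v ≢ p → w ≢ p → (v , w) ∈ arcs P′
          arc⇒arc′ e∈ v≢p w≢p with vw , uv , x , x∈A , wx ← P.arc⁻ e∈ =
            P′.arc⁺ (arc′⁺ vw v≢p w≢p v≢b w≢b) (lower-reach uv u≢p u≢b v≢p v≢b) x∈A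
                    (lower-reach wx w≢p w≢b (leaf≢p (A⊆X x∈A)) (A∌b x∈A))
            where
            w≢b = ancestor≢b wx (A∌b x∈A)
            v≢b = ancestor≢b (step vw wx) (A∌b x∈A)

          arc′⇒arc : (v , w) ∈ arcs P′ → (v ≡ q × w ≡ a) ⊎ ((v , w) ∈ arcs P × v ≢ p × w ≢ p)
          arc′⇒arc e∈ with vw′ , uv , x , x∈A , wx ← P′.arc⁻ e∈ with arc′⁻ vw′
          ... | inj₁ qa = inj₁ qa
          ... | inj₂ (vw , v≢p , w≢p , _) = inj₂ (P.arc⁺ vw (lift-reach uv) x∈A (lift-reach wx) , v≢p , w≢p)

          qa′⇒p∈P : (q , a) ∈ arcs P′ → p ∈ verts P
          qa′⇒p∈P e∈ with _ , uq , x , x∈A , ax ← P′.arc⁻ e∈ =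
            P.vertex⁺ p∈V (lift-reach uq ++ᵖ step qp here) x∈A (step pa (lift-reach ax))

          arc-avoids-p : p ∉ verts P → (v , w) ∈ arcs P → v ≢ p × w ≢ p
          arc-avoids-p p∉P e∈ with vw , uv , x , x∈A , wx ← P.arc⁻ e∈ =
            (λ { refl → p∉P (P.vertex⁺ p∈V uv x∈A (step vw wx)) }) ,
            (λ { refl → p∉P (P.vertex⁺ p∈V (uv ++ᵖ step vw here) x∈A wx) })

          without-p : p ∉ verts P → P ≈ P′
          without-p p∉P = pathGraphs-≈ pg pg′
            (λ v∈ → vertex⇒vertex′ v∈ λ { refl → p∉P v∈ })
            (proj₁ ∘ vertex′⇒vertex)
            (λ { {v , w} e∈ → let v≢p , w≢p = arc-avoids-p p∉P e∈ in arc⇒arc′ e∈ v≢p w≢p })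
            (λ { {v , w} e∈ → arc′-in-P e∈ })
            where
            arc′-in-P : (v , w) ∈ arcs P′ → (v , w) ∈ arcs P
            arc′-in-P e∈ with arc′⇒arc e∈
            ... | inj₁ (refl , refl)  = ⊥-elim (p∉P (qa′⇒p∈P e∈))
            ... | inj₂ (e∈P , _ , _) = e∈P

          p∈P⇒a∈A : p ∈ verts P → a ∈ A
          p∈P⇒a∈A p∈P with _ , _ , x , x∈A , px ← P.vertex⁻ p∈P = subst (_∈ A) (p-descendant-in-A x∈A px) x∈A

          p∈P⇒u⇝q : p ∈ verts P → Reach G u q
          p∈P⇒u⇝q p∈P with _ , uw , wp ← path-lastArc {G = G} (proj₁ (proj₂ (P.vertex⁻ p∈P))) u≢p
                       with refl ← p-parent wp = uw

          indeg-p≡1 : (q , p) ∈ arcs P → indeg P p ≡ 1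
          indeg-p≡1 qp∈P =
            unique-all-≡⇒length≡1 (Unique.filter⁺ _ (IsPathGraph.arcsU pg)) into-p (∈-arcsInto⁺ qp∈P)
            where
            into-p : ∀ {e} → e ∈ arcsInto p (arcs P) → e ≡ (q , p)
            into-p {y , _} e∈ with e∈P , refl ← ∈-arcsInto⁻ {es = arcs P} e∈
                              with refl ← p-parent (proj₁ (P.arc⁻ e∈P)) = refl

          outdeg-p≡1 : (p , a) ∈ arcs P → outdeg P p ≡ 1
          outdeg-p≡1 pa∈P =
            unique-all-≡⇒length≡1 (Unique.filter⁺ _ (IsPathGraph.arcsU pg)) out-of-p (∈-arcsOutOf⁺ pa∈P)
            where
            out-of-p : ∀ {e} → e ∈ arcsOutOf p (arcs P) → e ≡ (p , a)
            out-of-p {_ , z} e∈ with e∈P , refl ← ∈-arcsOutOf⁻ {es = arcs P} e∈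
                                with pz , _ , _ , x∈A , zx ← P.arc⁻ e∈P
                                with p-child pz
            ... | inj₁ refl = refl
            ... | inj₂ refl = ⊥-elim (ancestor≢b zx (A∌b x∈A) refl)

          with-p : p ∈ verts P → ∃ λ Q → SimpStep P Q × Q ≈ P′
          with-p p∈P =
            suppression P q p a , suppress q p a p∈P (indeg-p≡1 qp∈P) (outdeg-p≡1 pa∈P) qp∈P pa∈P , Q≈P′
            where
            a∈A = p∈P⇒a∈A p∈P
            u⇝q = p∈P⇒u⇝q p∈P
            qp∈P : (q , p) ∈ arcs P
            qp∈P = P.arc⁺ qp u⇝q a∈A (step pa here)
            pa∈P : (p , a) ∈ arcs P
            pa∈P = P.arc⁺ pa (u⇝q ++ᵖ step qp here) a∈A here
            unique : Unique ((q , a) ∷ removeIncident p (arcs P))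
            unique = ¬Any⇒All¬ _ (λ e∈ → ¬qa (proj₁ (P.arc⁻ (proj₁ (∈-removeIncident⁻ e∈)))))
                   ∷ Unique.filter⁺ _ (IsPathGraph.arcsU pg)
            arcs⊆ : (q , a) ∷ removeIncident p (arcs P) ⊆ arcs P′
            arcs⊆ (here refl) = P′.arc⁺ (here refl) (lower-reach u⇝q u≢p u≢b q≢p q≢b) a∈A here
            arcs⊆ {v , w} (there e∈) with e∈P , v≢p , w≢p ← ∈-removeIncident⁻ e∈ = arc⇒arc′ e∈P v≢p w≢p
            arcs⊇ : arcs P′ ⊆ (q , a) ∷ removeIncident p (arcs P)
            arcs⊇ {v , w} e∈ with arc′⇒arc e∈
            ... | inj₁ (refl , refl)       = here refl
            ... | inj₂ (e∈P , v≢p , w≢p) = there (∈-removeIncident⁺ e∈P v≢p w≢p)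
            Q≈P′ : suppression P q p a ≈ P′
            Q≈P′ = record
              { verts⊆ = λ v∈ → let v∈P , v≢p = ∈-removeVert⁻ v∈ in vertex⇒vertex′ v∈P v≢p
              ; verts⊇ = λ v∈ → let v∈P , v≢p = vertex′⇒vertex v∈ in ∈-removeVert⁺ v∈P v≢p
              ; arcs↭  = unique-⊆⇒↭ unique (IsPathGraph.arcsU pg′) arcs⊆ arcs⊇ }

          pathGraph-⇝≈ : P ⇝≈ P′
          pathGraph-⇝≈ with p ∈? verts P
          ... | no p∉P  = inj₁ (without-p p∉P)
          ... | yes p∈P = inj₂ (with-p p∈P)

reduceLeaf-pathGraphs-⇝≈ : ∀ {G X a b G′ A u u′ P P′} → IsBigNetwork G X → a ∈ X → b ∈ X → a ≢ b →
  ReduceLeaf G a b G′ → All (λ x → x ∈ X × x ≢ b) A → IsLsa G A u → IsLsa G′ A u′ →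
  IsPathGraph G A u P → IsPathGraph G′ A u′ P′ → P ⇝≈ P′
reduceLeaf-pathGraphs-⇝≈ {A = []} _ _ _ _ _ _ _ _ pg pg′ = inj₁ (pathGraphs-[]-≈ pg pg′)
reduceLeaf-pathGraphs-⇝≈ {A = _ ∷ _} N a∈X b∈X a≢b (atRoot _ pa pb p-in0) A⊆X∖b lsa lsa′ pg pg′ =
  inj₁ (CherryReduction.Leaves.atRoot-pathGraphs-≈ N a∈X b∈X a≢b pa pb A⊆X∖b p-in0 (here refl) lsa lsa′ pg pg′)
reduceLeaf-pathGraphs-⇝≈ {A = _ ∷ _} N a∈X b∈X a≢b (inner _ _ pa pb qp) A⊆X∖b lsa lsa′ pg pg′
  = pathGraph-⇝≈ pg (subst (λ r → IsPathGraph _ _ r _) (sym (lsa-unique lsa′)) pg′)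
  where open CherryReduction.Inner.OnLeaves.Lsa N a∈X b∈X a≢b pa pb qp A⊆X∖b lsa (here refl)

≈⇒Iso : ∀ {A S T} → S ≈ T → Iso A S T
≈⇒Iso S≈T = id , id , (λ _ v∈ → verts⊆ S≈T v∈ , refl) , (λ _ v∈ → verts⊇ S≈T v∈ , refl) ,
            subst (_↭ _) (sym (map-id _)) (arcs↭ S≈T) , λ _ _ → refl

lemma3p4 : (G : Graph) (X : List ℕ) (a b : ℕ) (G' : Graph) →
    IsNetwork G X → Cherry G X a b → ReduceLeaf G a b G' →
    (A : List ℕ) → All (λ x → x ∈ X × x ≢ b) A →
    SameExhibited A G G'
lemma3p4 _ _ _ _ _ (inj₂ (_ , refl , refl)) (_ , _ , _ , _ , () , _) _ _ _
lemma3p4 _ _ _ _ _ (inj₁ N) (a∈X , b∈X , a≢b , _) reduction _ A⊆X∖b _ _ _ _ _ _ lsa lsa′ pg pg′ S-full S′-full =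
  ≈⇒Iso (fullSimplification-resp-⇝≈ (PathGraph.acyclic pg (IsBigNetwork.acyclic N))
          (reduceLeaf-pathGraphs-⇝≈ N a∈X b∈X a≢b reduction A⊆X∖b lsa lsa′ pg pg′) S-full S′-full)
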